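{- Let $q$ be a prime power and let $X = \{ \langle(1, x, x^2, x^3, y, y^2, y^3)\rangle : x, y \in \mathbb{F}_q\}$, a set of points of $\mathrm{PG}(6,q)$. Let $s_1, s_2, s_3, s_4 \in X$ be four pairwise distinct points lying in a common plane of $\mathrm{PG}(6,q)$, where $s_i = \langle (1, x_i, x_i^2, x_i^3, y_i, y_i^2, y_i^3)\rangle$. Then $|\{x_1,x_2,x_3,x_4\}| = |\{y_1,y_2,y_3,y_4\}| = 2$.
   Context: $\mathrm{PG}(6,q)$ is the projective space whose points are the $1$-dimensional subspaces of $\mathbb{F}_q^{7}$; a plane is a $3$-dimensional vector subspace. -}

module Defs where

open import Level using (Level; _⊔_) renaming (suc to lsuc)
open import Algebra.Bundles using (CommutativeRing)
open import Data.Nat using (ℕ)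
open import Data.Fin using (Fin; zero; suc)
open import Data.Product using (Σ; ∃; _×_; _,_)
open import Data.Sum using (_⊎_)
open import Relation.Nullary using (¬_)
open import Relation.Binary.Definitions using (Decidable)

-- A finite field: a commutative ring with 0 ≠ 1 in which every nonzero
-- element is invertible, whose carrier is finite (enumerated by some Fin n).
-- (Every finite field is F_q for a prime power q and conversely.)
-- Equality of a finite set is decidable; we record this explicitly.
record FiniteField (c ℓ : Level) : Set (lsuc (c ⊔ ℓ)) where
  field
    commRing  : CommutativeRing c ℓ
  open CommutativeRing commRing public
  field
    0≉1       : ¬ (0# ≈ 1#)
    inverse   : ∀ x → ¬ (x ≈ 0#) → ∃ λ y → x * y ≈ 1#
    _≟_       : Decidable _≈_
    size      : ℕ
    enum      : Fin size → Carrier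
    enum-onto : ∀ x → ∃ λ i → enum i ≈ x

module _ {c ℓ : Level} (F : FiniteField c ℓ) where
  open FiniteField F

  Vec7 : Set c
  Vec7 = Fin 7 → Carrier

  pt : Carrier → Carrier → Vec7
  pt x y zero                                      = 1#
  pt x y (suc zero)                                = x
  pt x y (suc (suc zero))                          = x * x
  pt x y (suc (suc (suc zero)))                    = x * x * x
  pt x y (suc (suc (suc (suc zero))))              = y
  pt x y (suc (suc (suc (suc (suc zero)))))        = y * y
  pt x y (suc (suc (suc (suc (suc (suc zero)))))) = y * y * y

  lin3 : Carrier → Vec7 → Carrier → Vec7 → Carrier → Vec7 → Vec7
  lin3 a u b v d w k = a * u k + b * v k + d * w k

  _≈v_ : Vec7 → Vec7 → Set ℓ
  u ≈v v = ∀ k → u k ≈ v k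

  zeroV : Vec7
  zeroV _ = 0#

  LinIndep3 : Vec7 → Vec7 → Vec7 → Set (c ⊔ ℓ)
  LinIndep3 u v w = ∀ a b d → lin3 a u b v d w ≈v zeroV → (a ≈ 0#) × (b ≈ 0#) × (d ≈ 0#)

  InSpan3 : Vec7 → Vec7 → Vec7 → Vec7 → Set (c ⊔ ℓ)
  InSpan3 u v w s = ∃ λ a → ∃ λ b → ∃ λ d → s ≈v lin3 a u b v d w

  -- the four points <s₁>,…,<s₄> lie in a common plane of PG(6,q),
  -- i.e. a 3-dimensional subspace of F_q^7
  InCommonPlane : Vec7 → Vec7 → Vec7 → Vec7 → Set (c ⊔ ℓ)
  InCommonPlane s₁ s₂ s₃ s₄ =
    Σ Vec7 λ u → Σ Vec7 λ v → Σ Vec7 λ w →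
      LinIndep3 u v w ×
      InSpan3 u v w s₁ × InSpan3 u v w s₂ × InSpan3 u v w s₃ × InSpan3 u v w s₄

  -- the points <pt x y> and <pt x' y'> are distinct (both representatives
  -- have first coordinate 1, so they are equal iff the vectors are equal)
  DistinctPts : Carrier → Carrier → Carrier → Carrier → Set ℓ
  DistinctPts x y x' y' = ¬ (pt x y ≈v pt x' y')

  TwoValues : Carrier → Carrier → Carrier → Carrier → Set (c ⊔ ℓ)
  TwoValues a₁ a₂ a₃ a₄ =
    Σ Carrier λ p → Σ Carrier λ r →
      ¬ (p ≈ r) ×
      ((a₁ ≈ p ⊎ a₁ ≈ r) × (a₂ ≈ p ⊎ a₂ ≈ r) × (a₃ ≈ p ⊎ a₃ ≈ r) × (a₄ ≈ p ⊎ a₄ ≈ r)) ×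
      (a₁ ≈ p ⊎ a₂ ≈ p ⊎ a₃ ≈ p ⊎ a₄ ≈ p) ×
      (a₁ ≈ r ⊎ a₂ ≈ r ⊎ a₃ ≈ r ⊎ a₄ ≈ r)

{-# OPTIONS --safe #-}
-- Four vectors in the span of three are linearly dependent, so Σᵢ cᵢ sᵢ = 0 for weights c that
-- are not all zero. Coordinatewise, the weights annihilate 1, x, x², x³ at the x-values, hence
-- every cubic in x; evaluating a cubic that vanishes at all x-values except z shows that the
-- weights of the points with x-coordinate z sum to zero, and likewise for y. So a point of
-- nonzero weight shares its x-value with a second such point and its y-value with a third; as the
-- points are distinct, both the x- and the y-values split the four points into two pairs.
module Submission where

open import Defs
open import Level using (Level)
open import Data.Nat using (zero; suc)
open import Data.Product using (_×_; _,_; ∃; ∃₂; proj₁; proj₂)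
open import Data.Sum using (_⊎_; inj₁; inj₂)
open import Data.Fin using (Fin; zero; suc; punchIn; punchOut) renaming (_≟_ to _≟ᶠ_)
open import Data.Fin.Patterns using (0F; 1F; 2F; 3F; 4F; 5F; 6F)
open import Data.Fin.Properties using (any?; all?; punchInᵢ≢i; punchIn-punchOut)
open import Data.Vec.Functional using (_∷_; []; insertAt; removeAt)
open import Data.Vec.Functional.Properties using (insertAt-lookup; insertAt-punchIn)
open import Function using (_∘_)
open import Relation.Nullary using (¬_; Dec; yes; no; ¬?; contradiction)
open import Relation.Nullary.Decidable using (⌊_⌋; from-yes; _×-dec_; _⊎-dec_; _→-dec_)
open import Relation.Binary.PropositionalEquality as ≡ using (_≡_; _≢_; ≢-sym)
open import Data.Bool using (if_then_else_)
import Algebra.Solver.Ring.NaturalCoefficients.Default as NaturalSolver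
import Algebra.Properties.Ring as RingProperties
import Algebra.Properties.Group as GroupProperties
import Algebra.Properties.CommutativeSemigroup as CommutativeSemigroupProperties
import Algebra.Properties.Semiring.Sum as SemiringSum
import Algebra.Properties.CommutativeMonoid.Sum as CommutativeMonoidSum

Exhaustive₄ : Set
Exhaustive₄ = ∀ (i j k l m : Fin 4) → i ≢ j → i ≢ k → i ≢ l → j ≢ k → j ≢ l → k ≢ l →
              m ≡ i ⊎ m ≡ j ⊎ m ≡ k ⊎ m ≡ l

-- Opaque, so that uses of the lemma do not unfold the exhaustive check.
opaque
  distinct₄-exhaustive : Exhaustive₄
  distinct₄-exhaustive = from-yes decision
    where
    decision : Dec Exhaustive₄
    decision = all? λ i → all? λ j → all? λ k → all? λ l → all? λ m →
      ¬? (i ≟ᶠ j) →-dec ¬? (i ≟ᶠ k) →-dec ¬? (i ≟ᶠ l) →-dec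
      ¬? (j ≟ᶠ k) →-dec ¬? (j ≟ᶠ l) →-dec ¬? (k ≟ᶠ l) →-dec
      (m ≟ᶠ i ⊎-dec m ≟ᶠ j ⊎-dec m ≟ᶠ k ⊎-dec m ≟ᶠ l)

module OverField {ℓ₁ ℓ₂ : Level} (F : FiniteField ℓ₁ ℓ₂) where
  open FiniteField F hiding (zero)
  open RingProperties ring using (-‿distribˡ-*; x[y-z]≈xy-xz)
  open GroupProperties +-group using (x∙y⁻¹≈ε⇒x≈y; x≈y⇒x∙y⁻¹≈ε)
  open CommutativeSemigroupProperties *-commutativeSemigroup using (x∙yz≈y∙xz)
  open SemiringSum semiring using (sum; sum-syntax; sum-remove; sum-cong-≋; sum-replicate-zero;
                                   ∑-distrib-+; ∑-comm; *-distribˡ-sum; *-distribʳ-sum)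
  open CommutativeMonoidSum *-commutativeMonoid using ()
    renaming (sum to ∏; sum-remove to ∏-remove; sum-cong-≋ to ∏-cong)
  open NaturalSolver commutativeSemiring using (solve; _:=_; _:+_; _:*_; con)
  open import Relation.Binary.Reasoning.Setoid setoid

  1≉0 : 1# ≉ 0#
  1≉0 1≈0 = 0≉1 (sym 1≈0)

  *-nonzero : ∀ {x y} → x ≉ 0# → y ≉ 0# → x * y ≉ 0#
  *-nonzero {x} {y} x≉0 y≉0 xy≈0 with x⁻¹ , xx⁻¹≈1 ← inverse x x≉0 = y≉0 (begin
    y              ≈⟨ *-identityʳ y ⟨
    y * 1#         ≈⟨ *-congˡ xx⁻¹≈1 ⟨
    y * (x * x⁻¹)  ≈⟨ solve 3 (λ y x x⁻¹ → y :* (x :* x⁻¹) := x⁻¹ :* (x :* y)) refl y x x⁻¹ ⟩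
    x⁻¹ * (x * y)  ≈⟨ *-congˡ xy≈0 ⟩
    x⁻¹ * 0#       ≈⟨ zeroʳ x⁻¹ ⟩
    0#             ∎)

  x*y≈0⇒x≈0 : ∀ {x y} → y ≉ 0# → x * y ≈ 0# → x ≈ 0#
  x*y≈0⇒x≈0 {x} y≉0 xy≈0 with x ≟ 0#
  ... | yes x≈0 = x≈0
  ... | no  x≉0 = contradiction xy≈0 (*-nonzero x≉0 y≉0)

  sum-zeros : ∀ {n} {f : Fin n → Carrier} → (∀ i → f i ≈ 0#) → sum f ≈ 0#
  sum-zeros {n} f≈0 = trans (sum-cong-≋ f≈0) (sum-replicate-zero n)

  sum-concentrated : ∀ {n} (f : Fin (suc n) → Carrier) i → (∀ j → j ≢ i → f j ≈ 0#) → sum f ≈ f i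
  sum-concentrated f i elsewhere = begin
    sum f                   ≈⟨ sum-remove {i = i} f ⟩
    f i + sum (removeAt f i) ≈⟨ +-congˡ (sum-zeros λ j → elsewhere (punchIn i j) (punchInᵢ≢i i j)) ⟩
    f i + 0#                ≈⟨ +-identityʳ (f i) ⟩
    f i                     ∎

  ∏-zero : ∀ {n} (f : Fin (suc n) → Carrier) i → f i ≈ 0# → ∏ f ≈ 0#
  ∏-zero f i fᵢ≈0 = trans (∏-remove {i = i} f) (trans (*-congʳ fᵢ≈0) (zeroˡ _))

  ∏-nonzero : ∀ {n} (f : Fin n → Carrier) → (∀ i → f i ≉ 0#) → ∏ f ≉ 0#
  ∏-nonzero {zero}  f _  = 1≉0
  ∏-nonzero {suc n} f nz = *-nonzero (nz 0F) (∏-nonzero (f ∘ suc) (nz ∘ suc))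

  NonTrivial : ∀ {m} → (Fin m → Carrier) → Set ℓ₂
  NonTrivial c = ∃ λ i → c i ≉ 0#

  Dependency : ∀ {m n} → (Fin m → Fin n → Carrier) → (Fin m → Carrier) → Set ℓ₂
  Dependency {m} t c = ∀ k → ∑[ i < m ] (c i * t i k) ≈ 0#

  eliminate : ∀ {m n} → (Fin (suc m) → Fin (suc n) → Carrier) → Fin (suc m) → Carrier →
              Fin m → Fin (suc n) → Carrier
  eliminate t p a j k = a * t (punchIn p j) k - t (punchIn p j) 0F * t p k

  lift : ∀ {m n} → (Fin (suc m) → Fin (suc n) → Carrier) → Fin (suc m) → Carrier →
         (Fin m → Carrier) → Fin (suc m) → Carrier
  lift {m} t p a c = insertAt (λ j → a * c j) p (∑[ j < m ] (- (c j * t (punchIn p j) 0F)))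

  lift-combination : ∀ {m n} (t : Fin (suc m) → Fin (suc n) → Carrier) p a c k →
    ∑[ i < suc m ] (lift t p a c i * t i k) ≈ ∑[ j < m ] (c j * eliminate t p a j k)
  lift-combination {m} {n} t p a c k = begin
    ∑[ i < suc m ] (lift t p a c i * t i k)
      ≈⟨ sum-remove {i = p} (λ i → lift t p a c i * t i k) ⟩
    lift t p a c p * t p k + ∑[ j < m ] (lift t p a c (punchIn p j) * T j k)
      ≈⟨ +-cong (*-congʳ (reflexive (insertAt-lookup (λ j → a * c j) p _)))
                (sum-cong-≋ λ j → *-congʳ (reflexive (insertAt-punchIn (λ j → a * c j) p _ j))) ⟩
    (∑[ j < m ] (- (c j * T j 0F))) * t p k + ∑[ j < m ] (a * c j * T j k)
      ≈⟨ +-congʳ (*-distribʳ-sum (t p k) (λ j → - (c j * T j 0F))) ⟩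
    ∑[ j < m ] (- (c j * T j 0F) * t p k) + ∑[ j < m ] (a * c j * T j k)
      ≈⟨ ∑-distrib-+ (λ j → - (c j * T j 0F) * t p k) (λ j → a * c j * T j k) ⟨
    ∑[ j < m ] (- (c j * T j 0F) * t p k + a * c j * T j k)
      ≈⟨ sum-cong-≋ (λ j → row j) ⟩
    ∑[ j < m ] (c j * eliminate t p a j k) ∎
    where
    T : Fin m → Fin (suc n) → Carrier
    T j = t (punchIn p j)
    row : ∀ j → - (c j * T j 0F) * t p k + a * c j * T j k ≈ c j * eliminate t p a j k
    row j = begin
      - (γ * τ) * π + a * γ * σ  ≈⟨ +-congʳ (-‿distribˡ-* (γ * τ) π) ⟨
      - (γ * τ * π) + a * γ * σ  ≈⟨ +-comm _ _ ⟩
      a * γ * σ - γ * τ * π      ≈⟨ +-cong (solve 3 (λ a γ σ → a :* γ :* σ := γ :* (a :* σ)) refl a γ σ)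
                                           (-‿cong (*-assoc γ τ π)) ⟩
      γ * (a * σ) - γ * (τ * π)  ≈⟨ x[y-z]≈xy-xz γ (a * σ) (τ * π) ⟨
      γ * (a * σ - τ * π)        ∎
      where
      γ = c j
      τ = T j 0F
      σ = T j k
      π = t p k

  -- The condition says that `eliminate t p a` clears column 0; if that column is zero,
  -- any row together with a = 1 qualifies.
  pivot : ∀ {m} (v : Fin (suc m) → Carrier) →
          ∃₂ λ p a → a ≉ 0# × (∀ j → a * v (punchIn p j) ≈ v (punchIn p j) * v p)
  pivot v with any? (λ p → ¬? (v p ≟ 0#))
  ... | yes (p , vₚ≉0) = p , v p , vₚ≉0 , λ j → *-comm (v p) _
  ... | no  none       = 0F , 1# , 1≉0 , λ j → begin
    1# * v (suc j)    ≈⟨ *-identityˡ _ ⟩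
    v (suc j)         ≈⟨ vanishes (suc j) ⟩
    0#                ≈⟨ zeroˡ (v 0F) ⟨
    0# * v 0F         ≈⟨ *-congʳ (vanishes (suc j)) ⟨
    v (suc j) * v 0F  ∎
    where
    vanishes : ∀ q → v q ≈ 0#
    vanishes q with v q ≟ 0#
    ... | yes vq≈0 = vq≈0
    ... | no  vq≉0 = contradiction (q , vq≉0) none

  rows-dependent : ∀ n (t : Fin (suc n) → Fin n → Carrier) → ∃ λ c → NonTrivial c × Dependency t c
  rows-dependent zero    t = (λ _ → 1#) , (0F , 1≉0) , λ ()
  rows-dependent (suc n) t
    with p , a , a≉0 , clears ← pivot (λ i → t i 0F)
    with c , (j , cⱼ≉0) , c-dependency ← rows-dependent n (λ j k → eliminate t p a j (suc k))
    = lift t p a c , (punchIn p j , lift-nonzero) , λ k → trans (lift-combination t p a c k) (column k)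
    where
    lift-nonzero : lift t p a c (punchIn p j) ≉ 0#
    lift-nonzero = *-nonzero a≉0 cⱼ≉0 ∘ trans (reflexive (≡.sym (insertAt-punchIn _ p _ j)))
    column : ∀ k → ∑[ j < suc n ] (c j * eliminate t p a j k) ≈ 0#
    column 0F      = sum-zeros λ j → trans (*-congˡ (x≈y⇒x∙y⁻¹≈ε (clears j))) (zeroʳ (c j))
    column (suc k) = c-dependency k

  span3-combination : ∀ {n u v w} (s : Fin n → Vec7 F) (t : Fin n → Fin 3 → Carrier) →
    (∀ i → _≈v_ F (s i) (lin3 F (t i 0F) u (t i 1F) v (t i 2F) w)) →
    ∀ c → Dependency t c → ∀ m → ∑[ i < n ] (c i * s i m) ≈ 0#
  span3-combination {n} {u} {v} {w} s t expansion c dependency m = begin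
    ∑[ i < n ] (c i * s i m)
      ≈⟨ sum-cong-≋ (λ i → trans (*-congˡ (expansion i m))
                                 (distribute (c i) (t i 0F) (t i 1F) (t i 2F) (u m) (v m) (w m))) ⟩
    ∑[ i < n ] (c i * t i 0F * u m + c i * t i 1F * v m + c i * t i 2F * w m)
      ≈⟨ trans (∑-distrib-+ (λ i → c i * t i 0F * u m + c i * t i 1F * v m) (λ i → c i * t i 2F * w m))
               (+-congʳ (∑-distrib-+ (λ i → c i * t i 0F * u m) (λ i → c i * t i 1F * v m))) ⟩
    ∑[ i < n ] (c i * t i 0F * u m) + ∑[ i < n ] (c i * t i 1F * v m) + ∑[ i < n ] (c i * t i 2F * w m)
      ≈⟨ +-cong (+-cong (scaled 0F (u m)) (scaled 1F (v m))) (scaled 2F (w m)) ⟩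
    0# + 0# + 0#
      ≈⟨ trans (+-identityʳ (0# + 0#)) (+-identityʳ 0#) ⟩
    0# ∎
    where
    distribute : ∀ γ a b d U V W → γ * (a * U + b * V + d * W) ≈ γ * a * U + γ * b * V + γ * d * W
    distribute = solve 7 (λ γ a b d U V W →
      γ :* (a :* U :+ b :* V :+ d :* W) := γ :* a :* U :+ γ :* b :* V :+ γ :* d :* W) refl
    scaled : ∀ k e → ∑[ i < n ] (c i * t i k * e) ≈ 0#
    scaled k e = trans (sym (*-distribʳ-sum e (λ i → c i * t i k)))
                       (trans (*-congʳ (dependency k)) (zeroˡ e))

  span3-dependent : ∀ {u v w} (s : Fin 4 → Vec7 F) → (∀ i → InSpan3 F u v w (s i)) →
                    ∃ λ c → NonTrivial c × ∀ m → ∑[ i < 4 ] (c i * s i m) ≈ 0#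
  span3-dependent {u} {v} {w} s spans =
    let c , nontrivial , dependency = rows-dependent 3 coefficients
    in  c , nontrivial , span3-combination s coefficients expansion c dependency
    where
    coefficients : Fin 4 → Fin 3 → Carrier
    coefficients i 0F = proj₁ (spans i)
    coefficients i 1F = proj₁ (proj₂ (spans i))
    coefficients i 2F = proj₁ (proj₂ (proj₂ (spans i)))
    expansion : ∀ i → _≈v_ F (s i) (lin3 F (coefficients i 0F) u (coefficients i 1F) v (coefficients i 2F) w)
    expansion i = proj₂ (proj₂ (proj₂ (spans i)))

  mono : Fin 4 → Carrier → Carrier
  mono 0F X = 1#
  mono 1F X = X
  mono 2F X = X * X
  mono 3F X = X * X * X

  MomentsVanish : ∀ {n} → (c a : Fin n → Carrier) → Set ℓ₂
  MomentsVanish {n} c a = ∀ k → ∑[ i < n ] (c i * mono k (a i)) ≈ 0#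

  annihilates-span : ∀ {n d} (φ : Fin d → Carrier → Carrier) (c a : Fin n → Carrier) →
    (∀ k → ∑[ i < n ] (c i * φ k (a i)) ≈ 0#) →
    ∀ (p : Fin d → Carrier) → ∑[ i < n ] (c i * ∑[ k < d ] (p k * φ k (a i))) ≈ 0#
  annihilates-span {n} {d} φ c a moments p = begin
    ∑[ i < n ] (c i * ∑[ k < d ] (p k * φ k (a i)))
      ≈⟨ sum-cong-≋ (λ i → *-distribˡ-sum (c i) (λ k → p k * φ k (a i))) ⟩
    ∑[ i < n ] ∑[ k < d ] (c i * (p k * φ k (a i)))
      ≈⟨ ∑-comm (λ i k → c i * (p k * φ k (a i))) ⟩
    ∑[ k < d ] ∑[ i < n ] (c i * (p k * φ k (a i)))
      ≈⟨ sum-cong-≋ (λ k → sum-cong-≋ (λ i → x∙yz≈y∙xz (c i) (p k) (φ k (a i)))) ⟩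
    ∑[ k < d ] ∑[ i < n ] (p k * (c i * φ k (a i)))
      ≈⟨ sum-cong-≋ (λ k → *-distribˡ-sum (p k) (λ i → c i * φ k (a i))) ⟨
    ∑[ k < d ] (p k * ∑[ i < n ] (c i * φ k (a i)))
      ≈⟨ sum-zeros (λ k → trans (*-congˡ (moments k)) (zeroʳ (p k))) ⟩
    0# ∎

  record Affine : Set ℓ₁ where
    constructor _X+_
    field
      slope offset : Carrier

  open Affine

  eval : Affine → Carrier → Carrier
  eval f X = slope f * X + offset f

  eval-cong : ∀ f {X Y} → X ≈ Y → eval f X ≈ eval f Y
  eval-cong f X≈Y = +-congʳ (*-congˡ X≈Y)

  cubicCoefficients : (Fin 3 → Affine) → Fin 4 → Carrier
  cubicCoefficients f 0F = offset (f 0F) * (offset (f 1F) * offset (f 2F))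
  cubicCoefficients f 1F = slope (f 0F) * (offset (f 1F) * offset (f 2F))
                         + offset (f 0F) * (slope (f 1F) * offset (f 2F))
                         + offset (f 0F) * (offset (f 1F) * slope (f 2F))
  cubicCoefficients f 2F = slope (f 0F) * (slope (f 1F) * offset (f 2F))
                         + slope (f 0F) * (offset (f 1F) * slope (f 2F))
                         + offset (f 0F) * (slope (f 1F) * slope (f 2F))
  cubicCoefficients f 3F = slope (f 0F) * (slope (f 1F) * slope (f 2F))

  ∏-affine₃ : ∀ (f : Fin 3 → Affine) X →
    ∏ (λ j → eval (f j) X) ≈ ∑[ k < 4 ] (cubicCoefficients f k * mono k X)
  ∏-affine₃ f X = solve 7 (λ α₀ β₀ α₁ β₁ α₂ β₂ X →
    (α₀ :* X :+ β₀) :* ((α₁ :* X :+ β₁) :* ((α₂ :* X :+ β₂) :* con 1))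
      := β₀ :* (β₁ :* β₂) :* con 1
       :+ ((α₀ :* (β₁ :* β₂) :+ β₀ :* (α₁ :* β₂) :+ β₀ :* (β₁ :* α₂)) :* X
       :+ ((α₀ :* (α₁ :* β₂) :+ α₀ :* (β₁ :* α₂) :+ β₀ :* (α₁ :* α₂)) :* (X :* X)
       :+ (α₀ :* (α₁ :* α₂) :* (X :* X :* X) :+ con 0))))
    refl (slope (f 0F)) (offset (f 0F)) (slope (f 1F)) (offset (f 1F))
         (slope (f 2F)) (offset (f 2F)) X

  separator : Carrier → Carrier → Affine
  separator z a with a ≟ z
  ... | yes _ = 0# X+ 1#
  ... | no  _ = 1# X+ (- a)

  separator-root : ∀ {z a} → a ≉ z → eval (separator z a) a ≈ 0#
  separator-root {z} {a} a≉z with a ≟ z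
  ... | yes a≈z = contradiction a≈z a≉z
  ... | no  _   = trans (+-congʳ (*-identityˡ a)) (-‿inverseʳ a)

  separator-nonzero : ∀ z a → eval (separator z a) z ≉ 0#
  separator-nonzero z a with a ≟ z
  ... | yes _   = 1≉0 ∘ trans (sym (trans (+-congʳ (zeroˡ z)) (+-identityˡ 1#)))
  ... | no  a≉z = λ z-a≈0 → a≉z (sym (x∙y⁻¹≈ε⇒x≈y z a (trans (sym (+-congʳ (*-identityˡ z))) z-a≈0)))

  classSum : ∀ {n} → (a c : Fin n → Carrier) → Carrier → Carrier
  classSum {n} a c z = ∑[ i < n ] (if ⌊ a i ≟ z ⌋ then c i else 0#)

  -- Σᵢ cᵢ P(aᵢ) = 0 for the cubic P = ∏_{j ≠ h} separator (a h) (a j), which vanishes at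
  -- every aᵢ outside the class of a h and is a nonzero constant on that class.
  classSum-vanishes : ∀ (a c : Fin 4 → Carrier) → MomentsVanish c a → ∀ h → classSum a c (a h) ≈ 0#
  classSum-vanishes a c moments h = x*y≈0⇒x≈0 P-nonzero weighted
    where
    z : Carrier
    z = a h
    factors : Fin 3 → Affine
    factors j = separator z (a (punchIn h j))
    P : Carrier → Carrier
    P X = ∏ (λ j → eval (factors j) X)
    P-nonzero : P z ≉ 0#
    P-nonzero = ∏-nonzero (λ j → eval (factors j) z) (λ j → separator-nonzero z (a (punchIn h j)))
    at-point : ∀ i → c i * P (a i) ≈ (if ⌊ a i ≟ z ⌋ then c i else 0#) * P z
    at-point i with a i ≟ z
    ... | yes aᵢ≈z = *-congˡ (∏-cong λ j → eval-cong (factors j) aᵢ≈z)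
    ... | no  aᵢ≉z = begin
      c i * P (a i)  ≈⟨ *-congˡ (∏-zero (λ j → eval (factors j) (a i)) (punchOut h≢i) root) ⟩
      c i * 0#       ≈⟨ zeroʳ (c i) ⟩
      0#             ≈⟨ zeroˡ (P z) ⟨
      0# * P z       ∎
      where
      h≢i : h ≢ i
      h≢i ≡.refl = aᵢ≉z refl
      root : eval (factors (punchOut h≢i)) (a i) ≈ 0#
      root = trans (reflexive (≡.cong (λ q → eval (separator z (a q)) (a i)) (punchIn-punchOut h≢i)))
                   (separator-root aᵢ≉z)
    weighted : classSum a c z * P z ≈ 0#
    weighted = begin
      classSum a c z * P z
        ≈⟨ *-distribʳ-sum (P z) (λ i → if ⌊ a i ≟ z ⌋ then c i else 0#) ⟩
      ∑[ i < 4 ] ((if ⌊ a i ≟ z ⌋ then c i else 0#) * P z)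
        ≈⟨ sum-cong-≋ at-point ⟨
      ∑[ i < 4 ] (c i * P (a i))
        ≈⟨ sum-cong-≋ (λ i → *-congˡ {c i} (∏-affine₃ factors (a i))) ⟩
      ∑[ i < 4 ] (c i * ∑[ k < 4 ] (cubicCoefficients factors k * mono k (a i)))
        ≈⟨ annihilates-span mono c a moments (cubicCoefficients factors) ⟩
      0# ∎

  partner : ∀ {n} (a c : Fin (suc n) → Carrier) {i} → classSum a c (a i) ≈ 0# → c i ≉ 0# →
            ∃ λ j → j ≢ i × a j ≈ a i × c j ≉ 0#
  partner a c {i} vanishes cᵢ≉0
    with any? (λ j → ¬? (j ≟ᶠ i) ×-dec a j ≟ a i ×-dec ¬? (c j ≟ 0#))
  ... | yes found = found
  ... | no  none  = contradiction (trans (sym class≈cᵢ) vanishes) cᵢ≉0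
    where
    own : (if ⌊ a i ≟ a i ⌋ then c i else 0#) ≡ c i
    own with a i ≟ a i
    ... | yes _ = ≡.refl
    ... | no  ¬refl = contradiction refl ¬refl
    others : ∀ j → j ≢ i → (if ⌊ a j ≟ a i ⌋ then c j else 0#) ≈ 0#
    others j j≢i with a j ≟ a i
    ... | no  _      = refl
    ... | yes aⱼ≈aᵢ with c j ≟ 0#
    ...   | yes cⱼ≈0 = cⱼ≈0
    ...   | no  cⱼ≉0 = contradiction (j , j≢i , aⱼ≈aᵢ , cⱼ≉0) none
    class≈cᵢ : classSum a c (a i) ≈ c i
    class≈cᵢ = trans (sum-concentrated (λ j → if ⌊ a j ≟ a i ⌋ then c j else 0#) i others) (reflexive own)

  cover⇒TwoValues : ∀ (a : Fin 4 → Carrier) {i k} → a i ≉ a k → (∀ m → a m ≈ a i ⊎ a m ≈ a k) →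
                    TwoValues F (a 0F) (a 1F) (a 2F) (a 3F)
  cover⇒TwoValues a {i} {k} aᵢ≉aₖ cover =
    a i , a k , aᵢ≉aₖ , (cover 0F , cover 1F , cover 2F , cover 3F) , attained i , attained k
    where
    attained : ∀ q → a 0F ≈ a q ⊎ a 1F ≈ a q ⊎ a 2F ≈ a q ⊎ a 3F ≈ a q
    attained 0F = inj₁ refl
    attained 1F = inj₂ (inj₁ refl)
    attained 2F = inj₂ (inj₂ (inj₁ refl))
    attained 3F = inj₂ (inj₂ (inj₂ refl))

  -- The second value a k has a partner l of its own, and i, j, k, l are then all of Fin 4.
  classes⇒TwoValues : ∀ (a c : Fin 4 → Carrier) → (∀ q → classSum a c (a q) ≈ 0#) →
    ∀ {i j k} → j ≢ i → k ≢ i → k ≢ j → a j ≈ a i → a k ≉ a i → c k ≉ 0# →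
    TwoValues F (a 0F) (a 1F) (a 2F) (a 3F)
  classes⇒TwoValues a c classes {i} {j} {k} j≢i k≢i k≢j aⱼ≈aᵢ aₖ≉aᵢ cₖ≉0
    with l , l≢k , aₗ≈aₖ , _ ← partner a c (classes k) cₖ≉0
    = cover⇒TwoValues a (aₖ≉aᵢ ∘ sym) cover
    where
    l≢i : l ≢ i
    l≢i ≡.refl = aₖ≉aᵢ (sym aₗ≈aₖ)
    l≢j : l ≢ j
    l≢j ≡.refl = aₖ≉aᵢ (trans (sym aₗ≈aₖ) aⱼ≈aᵢ)
    cover : ∀ m → a m ≈ a i ⊎ a m ≈ a k
    cover m with distinct₄-exhaustive i j k l m
                   (≢-sym j≢i) (≢-sym k≢i) (≢-sym l≢i) (≢-sym k≢j) (≢-sym l≢j) (≢-sym l≢k)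
    ... | inj₁ ≡.refl                   = inj₁ refl
    ... | inj₂ (inj₁ ≡.refl)            = inj₁ aⱼ≈aᵢ
    ... | inj₂ (inj₂ (inj₁ ≡.refl))     = inj₂ refl
    ... | inj₂ (inj₂ (inj₂ ≡.refl))     = inj₂ aₗ≈aₖ

  Apart : ∀ {n} → (x y : Fin n → Carrier) → Fin n → Fin n → Set ℓ₂
  Apart x y i j = ¬ (x i ≈ x j × y i ≈ y j)

  -- A nonzero weight cᵢ has an x-partner j and a y-partner k; they differ because the points
  -- are distinct, so x splits {i, j, k, ·} as {i, j} ∪ {k, ·} and y as {i, k} ∪ {j, ·}.
  apart⇒TwoValues : ∀ (x y c : Fin 4 → Carrier) → (∀ {i j} → i ≢ j → Apart x y i j) →
    (∀ q → classSum x c (x q) ≈ 0#) → (∀ q → classSum y c (y q) ≈ 0#) → NonTrivial c →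
    TwoValues F (x 0F) (x 1F) (x 2F) (x 3F) × TwoValues F (y 0F) (y 1F) (y 2F) (y 3F)
  apart⇒TwoValues x y c apart x-classes y-classes (i , cᵢ≉0)
    with j , j≢i , xⱼ≈xᵢ , cⱼ≉0 ← partner x c (x-classes i) cᵢ≉0
       | k , k≢i , yₖ≈yᵢ , cₖ≉0 ← partner y c (y-classes i) cᵢ≉0
    = classes⇒TwoValues x c x-classes j≢i k≢i k≢j xⱼ≈xᵢ xₖ≉xᵢ cₖ≉0
    , classes⇒TwoValues y c y-classes k≢i j≢i (≢-sym k≢j) yₖ≈yᵢ yⱼ≉yᵢ cⱼ≉0
    where
    xₖ≉xᵢ : x k ≉ x i
    xₖ≉xᵢ xₖ≈xᵢ = apart k≢i (xₖ≈xᵢ , yₖ≈yᵢ)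
    yⱼ≉yᵢ : y j ≉ y i
    yⱼ≉yᵢ yⱼ≈yᵢ = apart j≢i (xⱼ≈xᵢ , yⱼ≈yᵢ)
    k≢j : k ≢ j
    k≢j ≡.refl = yⱼ≉yᵢ yₖ≈yᵢ

  pt-cong : ∀ {x y x′ y′} → x ≈ x′ → y ≈ y′ → _≈v_ F (pt F x y) (pt F x′ y′)
  pt-cong x≈x′ y≈y′ 0F = refl
  pt-cong x≈x′ y≈y′ 1F = x≈x′
  pt-cong x≈x′ y≈y′ 2F = *-cong x≈x′ x≈x′
  pt-cong x≈x′ y≈y′ 3F = *-cong (*-cong x≈x′ x≈x′) x≈x′
  pt-cong x≈x′ y≈y′ 4F = y≈y′
  pt-cong x≈x′ y≈y′ 5F = *-cong y≈y′ y≈y′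
  pt-cong x≈x′ y≈y′ 6F = *-cong (*-cong y≈y′ y≈y′) y≈y′

  distinct-apart : ∀ {x y x′ y′} → DistinctPts F x y x′ y′ → ¬ (x ≈ x′ × y ≈ y′)
  distinct-apart distinct (x≈x′ , y≈y′) = distinct (pt-cong x≈x′ y≈y′)

  distinct-sym : ∀ {x y x′ y′} → DistinctPts F x y x′ y′ → DistinctPts F x′ y′ x y
  distinct-sym distinct p′≈p = distinct (sym ∘ p′≈p)

  module _ {x₁ y₁ x₂ y₂ x₃ y₃ x₄ y₄ : Carrier}
           (d₁₂ : DistinctPts F x₁ y₁ x₂ y₂) (d₁₃ : DistinctPts F x₁ y₁ x₃ y₃)
           (d₁₄ : DistinctPts F x₁ y₁ x₄ y₄) (d₂₃ : DistinctPts F x₂ y₂ x₃ y₃)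
           (d₂₄ : DistinctPts F x₂ y₂ x₄ y₄) (d₃₄ : DistinctPts F x₃ y₃ x₄ y₄) where

    pairwise-apart : ∀ {i j} → i ≢ j → Apart (x₁ ∷ x₂ ∷ x₃ ∷ x₄ ∷ []) (y₁ ∷ y₂ ∷ y₃ ∷ y₄ ∷ []) i j
    pairwise-apart {0F} {0F} 0≢0 = contradiction ≡.refl 0≢0
    pairwise-apart {0F} {1F} _   = distinct-apart d₁₂
    pairwise-apart {0F} {2F} _   = distinct-apart d₁₃
    pairwise-apart {0F} {3F} _   = distinct-apart d₁₄
    pairwise-apart {1F} {0F} _   = distinct-apart (distinct-sym d₁₂)
    pairwise-apart {1F} {1F} 1≢1 = contradiction ≡.refl 1≢1
    pairwise-apart {1F} {2F} _   = distinct-apart d₂₃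
    pairwise-apart {1F} {3F} _   = distinct-apart d₂₄
    pairwise-apart {2F} {0F} _   = distinct-apart (distinct-sym d₁₃)
    pairwise-apart {2F} {1F} _   = distinct-apart (distinct-sym d₂₃)
    pairwise-apart {2F} {2F} 2≢2 = contradiction ≡.refl 2≢2
    pairwise-apart {2F} {3F} _   = distinct-apart d₃₄
    pairwise-apart {3F} {0F} _   = distinct-apart (distinct-sym d₁₄)
    pairwise-apart {3F} {1F} _   = distinct-apart (distinct-sym d₂₄)
    pairwise-apart {3F} {2F} _   = distinct-apart (distinct-sym d₃₄)
    pairwise-apart {3F} {3F} 3≢3 = contradiction ≡.refl 3≢3

  coordinate-moments : ∀ (c x y : Fin 4 → Carrier) →
    (∀ m → ∑[ i < 4 ] (c i * pt F (x i) (y i) m) ≈ 0#) → MomentsVanish c x × MomentsVanish c y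
  coordinate-moments c x y vanishes = x-moments , y-moments
    where
    x-moments : MomentsVanish c x
    x-moments 0F = vanishes 0F
    x-moments 1F = vanishes 1F
    x-moments 2F = vanishes 2F
    x-moments 3F = vanishes 3F
    y-moments : MomentsVanish c y
    y-moments 0F = vanishes 0F
    y-moments 1F = vanishes 4F
    y-moments 2F = vanishes 5F
    y-moments 3F = vanishes 6F

  span3⇒TwoValues : ∀ (x y : Fin 4 → Carrier) → (∀ {i j} → i ≢ j → Apart x y i j) →
    ∀ {u v w} → (∀ i → InSpan3 F u v w (pt F (x i) (y i))) →
    TwoValues F (x 0F) (x 1F) (x 2F) (x 3F) × TwoValues F (y 0F) (y 1F) (y 2F) (y 3F)
  span3⇒TwoValues x y apart spans =
    let c , nontrivial , vanishes = span3-dependent (λ i → pt F (x i) (y i)) spans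
        x-moments , y-moments     = coordinate-moments c x y vanishes
    in  apart⇒TwoValues x y c apart
          (classSum-vanishes x c x-moments) (classSum-vanishes y c y-moments) nontrivial

lemma8 : {c ℓ : Level} (F : FiniteField c ℓ) →
    let open FiniteField F in
    (x₁ y₁ x₂ y₂ x₃ y₃ x₄ y₄ : Carrier) →
    DistinctPts F x₁ y₁ x₂ y₂ → DistinctPts F x₁ y₁ x₃ y₃ → DistinctPts F x₁ y₁ x₄ y₄ →
    DistinctPts F x₂ y₂ x₃ y₃ → DistinctPts F x₂ y₂ x₄ y₄ → DistinctPts F x₃ y₃ x₄ y₄ →
    InCommonPlane F (pt F x₁ y₁) (pt F x₂ y₂) (pt F x₃ y₃) (pt F x₄ y₄) →
    TwoValues F x₁ x₂ x₃ x₄ × TwoValues F y₁ y₂ y₃ y₄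
lemma8 F x₁ y₁ x₂ y₂ x₃ y₃ x₄ y₄ d₁₂ d₁₃ d₁₄ d₂₃ d₂₄ d₃₄ (u , v , w , _ , s₁ , s₂ , s₃ , s₄) =
  span3⇒TwoValues (x₁ ∷ x₂ ∷ x₃ ∷ x₄ ∷ []) (y₁ ∷ y₂ ∷ y₃ ∷ y₄ ∷ [])
    (pairwise-apart d₁₂ d₁₃ d₁₄ d₂₃ d₂₄ d₃₄) spans
  where
  open OverField F
  spans : ∀ i → InSpan3 F u v w (pt F ((x₁ ∷ x₂ ∷ x₃ ∷ x₄ ∷ []) i) ((y₁ ∷ y₂ ∷ y₃ ∷ y₄ ∷ []) i))
  spans 0F = s₁
  spans 1F = s₂
  spans 2F = s₃
  spans 3F = s₄
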